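{- Let $s=2k>2$ and let $\lambda$ be the partition whose bead-set is the set of positions $i+js$ occupied by beads in the $s$-abacus $\alpha(s)$ defined below. Then the $s$-core of $\lambda$ is empty, and for $0\le i\le k-1$ the $s$-quotient satisfies $\lambda_{(i)}=\lambda_{(s-1-i)}=\tau_{k-i-1}$, where $\tau_\ell=(\ell,\ell-1,\dots,1)$ and $\tau_0=\emptyset$.
   Context: An $s$-abacus has runners $0\le i\le s-1$ (left to right) and rows indexed from bottom to top; runner $i$, row $j$ corresponds to the integer $i+js$, and each position holds a bead or a spacer. For $s=2k>2$, $\alpha(s)$ has rows $0\le j\le 2k-3$ and, for each $0\le i\le k-1$, runners $i$ and $2k-1-i$ are identical, consisting of beads in rows $0,\dots,i-1$, then in rows $i,i+1,\dots$ alternately spacer, bead, spacer, bead, $\dots$ until the runner holds $k-1$ beads, then spacers up to row $2k-3$. A finite set $Y\subset\mathbb{N}$ (bead-set) determines the partition whose parts are the nonzero numbers $|\{z\notin Y:0\le z<y\}|$, $y\in Y$. The $s$-core of a partition is obtained by repeatedly removing rim hooks of length $s$ until none remain. For a bead-set $X$, set $X_i=\{j\ge0: i+js\in X\}$; the $s$-quotient is $(\lambda_{(0)},\dots,\lambda_{(s-1)})$ with $\lambda_{(i)}$ the partition determined by $X_i$. -}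

module Defs where

open import Data.Nat using (ℕ; zero; suc; _+_; _*_; _∸_; _<_; _≤_; _<ᵇ_; _≡ᵇ_)
open import Data.Nat.DivMod using (_/_; _%_)
open import Data.Bool using (Bool; true; false; _∧_; _∨_; not; if_then_else_)
open import Data.List using (List; []; _∷_; map; filter; reverse; length; upTo; downFrom)
open import Data.Nat.ListAction using (sum)
open import Data.Bool using (T?)
open import Data.List.Relation.Unary.All using (All)
open import Data.List.Relation.Unary.Linked using (Linked)
open import Data.Product using (_×_; _,_)
open import Data.Empty using (⊥)
open import Relation.Nullary using (¬_)
open import Relation.Binary.PropositionalEquality using (_≡_)
open import Relation.Binary.Construct.Closure.ReflexiveTransitive using (Star)
open import Relation.Nullary.Decidable using (does)
open import Data.Nat using (_≟_)

Partition : Set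
Partition = List ℕ

IsPartition : Partition → Set
IsPartition λ′ = Linked (λ a b → b ≤ a) λ′ × All (λ a → 0 < a) λ′

row : Partition → ℕ → ℕ
row []       _       = 0
row (x ∷ _)  zero    = x
row (_ ∷ xs) (suc r) = row xs r

Cell : Set
Cell = ℕ × ℕ

InDiagram : Partition → Cell → Set
InDiagram λ′ (r , c) = c < row λ′ r

InSkew : Partition → Partition → Cell → Set
InSkew λ′ μ x = InDiagram λ′ x × ¬ InDiagram μ x

data Conn (λ′ μ : Partition) : Cell → Cell → Set where
  here  : ∀ {x} → Conn λ′ μ x x
  right : ∀ {r c y} → InSkew λ′ μ (r , suc c) → Conn λ′ μ (r , suc c) y → Conn λ′ μ (r , c) y
  left  : ∀ {r c y} → InSkew λ′ μ (r , c) → Conn λ′ μ (r , c) y → Conn λ′ μ (r , suc c) y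
  down  : ∀ {r c y} → InSkew λ′ μ (suc r , c) → Conn λ′ μ (suc r , c) y → Conn λ′ μ (r , c) y
  up    : ∀ {r c y} → InSkew λ′ μ (r , c) → Conn λ′ μ (r , c) y → Conn λ′ μ (suc r , c) y

-- μ is obtained from λ by removing a rim hook (border strip) of length s:
-- μ ⊆ λ is a partition, λ / μ has s cells, is connected and contains no 2×2 square.
RemoveRimHook : ℕ → Partition → Partition → Set
RemoveRimHook s λ′ μ =
    IsPartition μ
  × (∀ r → row μ r ≤ row λ′ r)
  × (sum λ′ ≡ sum μ + s)
  × (∀ x y → InSkew λ′ μ x → InSkew λ′ μ y → Conn λ′ μ x y)
  × (∀ r c → InSkew λ′ μ (r , c) → InSkew λ′ μ (suc r , c)
           → InSkew λ′ μ (r , suc c) → InSkew λ′ μ (suc r , suc c) → ⊥)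

IsCore : ℕ → Partition → Partition → Set
IsCore s λ′ μ = Star (RemoveRimHook s) λ′ μ × (∀ ν → ¬ RemoveRimHook s μ ν)

-- Bead-sets, given as a Boolean predicate together with a bound N
-- (all beads lie in {0,…,N-1}).

count< : (ℕ → Bool) → ℕ → ℕ
count< Y y = length (filter (λ z → T? (not (Y z))) (upTo y))

-- partition determined by the bead-set Y ⊆ [0,N): the nonzero numbers
-- |{z ∉ Y : 0 ≤ z < y}| for y ∈ Y, listed in weakly decreasing order.
partitionOf : (ℕ → Bool) → ℕ → Partition
partitionOf Y N =
  reverse (filter (λ n → T? (not (n ≡ᵇ 0)))
                  (map (count< Y) (filter (λ y → T? (Y y)) (upTo N))))

runnerSet : ℕ → (ℕ → Bool) → ℕ → (ℕ → Bool)
runnerSet s X i j = X (i + j * s)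

-- i-th component of the s-quotient of the partition with bead-set X ⊆ [0,N)
-- (X_i ⊆ [0,N) as well)
quotientPart : ℕ → (ℕ → Bool) → ℕ → ℕ → Partition
quotientPart s X N i = partitionOf (runnerSet s X i) N

-- runner i with 0 ≤ i ≤ k-1 (and its mirror 2k-1-i), row j:
-- beads in rows 0..i-1, then from row i alternately spacer, bead, …
-- until k-1 beads, i.e. beads in rows i+1+2t for t < k-1-i;
-- only rows 0..2k-3 exist.
odd? : ℕ → Bool
odd? zero          = false
odd? (suc zero)    = true
odd? (suc (suc n)) = odd? n

runnerBead : ℕ → ℕ → ℕ → Bool
runnerBead k i j =
  (j <ᵇ (2 * k ∸ 2)) ∧
  ((j <ᵇ i) ∨ ((i <ᵇ j) ∧ odd? (j ∸ i) ∧ ((j ∸ i) <ᵇ (2 * (k ∸ 1 ∸ i)))))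

-- position n = r + j s on the 2k-abacus: runner r = n % s, row j = n / s
-- (for k = 0 the abacus is empty; only k ≥ 2 is used)
alphaBead : ℕ → ℕ → Bool
alphaBead zero    n = false
alphaBead (suc m) n = go (n % (2 * k)) (n / (2 * k))
  where
    k = suc m
    go : ℕ → ℕ → Bool
    go r j = if r <ᵇ k then runnerBead k r j else runnerBead k (2 * k ∸ 1 ∸ r) j

-- all beads of α(2k) lie below (2k)(2k-2)
alphaBound : ℕ → ℕ
alphaBound k = (2 * k) * (2 * k ∸ 2)

tau : ℕ → Partition
tau ℓ = map suc (downFrom ℓ)

-- Moving a bead from an occupied position y to an empty position y − s removes an s-rim hook
-- from the partition: the beads strictly between the two positions each lose one spacer below
-- them, and together with the moved bead they form the rows of the hook. On the s-abacus such a
-- move slides a bead one row down its runner, so letting the beads of every runner of α(2k)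
-- sink to the bottom removes s-rim hooks one at a time. Every runner carries k − 1 beads, so
-- the bead set reached is {0, …, (k − 1)s − 1}, whose partition is empty.
-- The quotient is read off runner by runner: leading beads contribute no parts, and after
-- the first spacer the j-th bead has exactly j spacers below it, which gives τ_{k−1−i}.
module Submission where

open import Data.Bool using (Bool; true; false; not; _∧_; _∨_; if_then_else_; T?)
open import Data.Bool.Properties using (T-≡; ∧-zeroʳ; ∧-identityʳ)
open import Data.Empty using (⊥; ⊥-elim)
open import Data.List using (List; []; _∷_; _∷ʳ_; _++_; map; filter; reverse; length; upTo; replicate)
open import Data.List.Properties using (upTo-∷ʳ; filter-++; map-++; reverse-++; length-++; downFrom-∷ʳ; map-downFrom)
open import Data.List.Relation.Unary.All using (All; []; _∷_) renaming (map to All-map)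
open import Data.List.Relation.Unary.Linked using (Linked; []; [-]; _∷_)
open import Data.Nat
open import Data.Nat.ListAction using (sum)
open import Data.Nat.ListAction.Properties using (sum-++)
open import Data.Nat.Properties
open import Data.Nat.DivMod
open import Data.Nat.Tactic.RingSolver using (solve-∀)
open import Data.Product using (Σ; _×_; _,_; proj₁; proj₂)
open import Function using (_∘_)
open import Function.Bundles using (Equivalence)
open import Relation.Binary.Construct.Closure.ReflexiveTransitive using (Star; ε; _◅_; _◅◅_)
open import Relation.Binary.PropositionalEquality
open import Relation.Nullary using (¬_; Dec; yes; no)

open import Defs

<⇒<ᵇ≡true : ∀ {m n} → m < n → (m <ᵇ n) ≡ true
<⇒<ᵇ≡true m<n = Equivalence.to T-≡ (<⇒<ᵇ m<n)

<ᵇ≡true⇒< : ∀ m n → (m <ᵇ n) ≡ true → m < n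
<ᵇ≡true⇒< m n e = <ᵇ⇒< m n (Equivalence.from T-≡ e)

<ᵇ≡false⇒≮ : ∀ {m n} → (m <ᵇ n) ≡ false → ¬ m < n
<ᵇ≡false⇒≮ e m<n with () ← trans (sym e) (<⇒<ᵇ≡true m<n)

≮⇒<ᵇ≡false : ∀ {m n} → ¬ m < n → (m <ᵇ n) ≡ false
≮⇒<ᵇ≡false {m} {n} m≮n with m <ᵇ n in e
... | false = refl
... | true  = ⊥-elim (m≮n (<ᵇ≡true⇒< m n e))

∧≡true : ∀ {a b} → a ∧ b ≡ true → a ≡ true × b ≡ true
∧≡true {true} {true} refl = refl , refl

∧-redundantˡ : ∀ {a b} → (b ≡ true → a ≡ true) → a ∧ b ≡ b
∧-redundantˡ {true}          _     = refl
∧-redundantˡ {false} {false} _     = refl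
∧-redundantˡ {false} {true}  b⇒a with () ← b⇒a refl

-- Bead sets, scanned upwards from position 0

countSpacer : Bool → ℕ → ℕ
countSpacer true  c = c
countSpacer false c = suc c

spacersBelow : (ℕ → Bool) → ℕ → ℕ
spacersBelow Y zero    = 0
spacersBelow Y (suc n) = countSpacer (Y n) (spacersBelow Y n)

spacersIn : (ℕ → Bool) → List ℕ → ℕ
spacersIn Y xs = length (filter (λ z → T? (not (Y z))) xs)

spacersIn-∷ʳ : ∀ Y n xs → spacersIn Y (xs ++ n ∷ []) ≡ countSpacer (Y n) (spacersIn Y xs)
spacersIn-∷ʳ Y n xs
  rewrite filter-++ (λ z → T? (not (Y z))) xs (n ∷ [])
        | length-++ (filter (λ z → T? (not (Y z))) xs) {filter (λ z → T? (not (Y z))) (n ∷ [])}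
  with Y n
... | true  = +-identityʳ _
... | false = +-comm _ 1

count<-suc : ∀ Y n → count< Y (suc n) ≡ countSpacer (Y n) (count< Y n)
count<-suc Y n = trans (cong (spacersIn Y) (sym (upTo-∷ʳ n))) (spacersIn-∷ʳ Y n (upTo n))

count<≡spacersBelow : ∀ Y n → count< Y n ≡ spacersBelow Y n
count<≡spacersBelow Y zero    = refl
count<≡spacersBelow Y (suc n) = trans (count<-suc Y n) (cong (countSpacer (Y n)) (count<≡spacersBelow Y n))

addPart : Bool → ℕ → Partition → Partition
addPart false c       p = p
addPart true  zero    p = p
addPart true  (suc c) p = suc c ∷ p

partitionOver : (ℕ → Bool) → List ℕ → Partition
partitionOver Y xs =
  reverse (filter (λ n → T? (not (n ≡ᵇ 0))) (map (count< Y) (filter (λ y → T? (Y y)) xs)))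

partitionOver-∷ʳ : ∀ Y n xs → partitionOver Y (xs ++ n ∷ []) ≡ addPart (Y n) (count< Y n) (partitionOver Y xs)
partitionOver-∷ʳ Y n xs
  rewrite filter-++ (λ y → T? (Y y)) xs (n ∷ [])
        | map-++ (count< Y) (filter (λ y → T? (Y y)) xs) (filter (λ y → T? (Y y)) (n ∷ []))
        | filter-++ (λ n → T? (not (n ≡ᵇ 0))) (map (count< Y) (filter (λ y → T? (Y y)) xs))
                    (map (count< Y) (filter (λ y → T? (Y y)) (n ∷ [])))
        | reverse-++ (filter (λ n → T? (not (n ≡ᵇ 0))) (map (count< Y) (filter (λ y → T? (Y y)) xs)))
                     (filter (λ n → T? (not (n ≡ᵇ 0))) (map (count< Y) (filter (λ y → T? (Y y)) (n ∷ []))))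
  with Y n
... | false = refl
... | true with count< Y n
...   | zero  = refl
...   | suc c = refl

partitionOf-suc : ∀ Y n → partitionOf Y (suc n) ≡ addPart (Y n) (spacersBelow Y n) (partitionOf Y n)
partitionOf-suc Y n = begin
  partitionOf Y (suc n)                                   ≡⟨ cong (partitionOver Y) (sym (upTo-∷ʳ n)) ⟩
  partitionOver Y (upTo n ++ n ∷ [])                      ≡⟨ partitionOver-∷ʳ Y n (upTo n) ⟩
  addPart (Y n) (count< Y n) (partitionOf Y n)            ≡⟨ cong (λ c → addPart (Y n) c (partitionOf Y n)) (count<≡spacersBelow Y n) ⟩
  addPart (Y n) (spacersBelow Y n) (partitionOf Y n)      ∎
  where open ≡-Reasoning

spacersBelow-cong : ∀ {Y Y′} → (∀ z → Y z ≡ Y′ z) → ∀ n → spacersBelow Y n ≡ spacersBelow Y′ n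
spacersBelow-cong e zero    = refl
spacersBelow-cong e (suc n) = cong₂ countSpacer (e n) (spacersBelow-cong e n)

partitionOf-cong : ∀ {Y Y′} → (∀ z → Y z ≡ Y′ z) → ∀ n → partitionOf Y n ≡ partitionOf Y′ n
partitionOf-cong         e zero    = refl
partitionOf-cong {Y} {Y′} e (suc n) = begin
  partitionOf Y (suc n)                                 ≡⟨ partitionOf-suc Y n ⟩
  addPart (Y n) (spacersBelow Y n) (partitionOf Y n)    ≡⟨ cong₂ (λ b c → addPart b c _) (e n) (spacersBelow-cong e n) ⟩
  addPart (Y′ n) (spacersBelow Y′ n) (partitionOf Y n)  ≡⟨ cong (addPart (Y′ n) (spacersBelow Y′ n)) (partitionOf-cong e n) ⟩
  addPart (Y′ n) (spacersBelow Y′ n) (partitionOf Y′ n) ≡⟨ partitionOf-suc Y′ n ⟨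
  partitionOf Y′ (suc n)                                ∎
  where open ≡-Reasoning

countSpacer-≥ : ∀ b c → c ≤ countSpacer b c
countSpacer-≥ true  c = ≤-refl
countSpacer-≥ false c = n≤1+n c

Linked-≥-∷ : ∀ {x p} → All (_≤ x) p → Linked (λ a b → b ≤ a) p → Linked (λ a b → b ≤ a) (x ∷ p)
Linked-≥-∷ []      [] = [-]
Linked-≥-∷ (h ∷ _) l  = h ∷ l

partitionOf-isPartition : ∀ Y n → IsPartition (partitionOf Y n)
partitionOf-isPartition Y n = proj₁ (bounded n)
  where
    bounded : ∀ n → IsPartition (partitionOf Y n) × All (_≤ spacersBelow Y n) (partitionOf Y n)
    bounded zero = ([] , []) , []
    bounded (suc n) rewrite partitionOf-suc Y n with bounded n
    ... | (dec , pos) , bnd with Y n | spacersBelow Y n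
    ...   | false | c     = (dec , pos) , All-map (λ h → ≤-trans h (n≤1+n c)) bnd
    ...   | true  | zero  = (dec , pos) , bnd
    ...   | true  | suc c = (Linked-≥-∷ bnd dec , s≤s z≤n ∷ pos) , ≤-refl ∷ bnd

-- Like partitionOf, but keeping the zero parts of beads with no spacer below: rim hooks are
-- easier to locate in this list, which has the same rows and sum.
beadParts : (ℕ → Bool) → ℕ → List ℕ
beadParts Y zero    = []
beadParts Y (suc n) = if Y n then spacersBelow Y n ∷ beadParts Y n else beadParts Y n

spacersBelow-bead : ∀ Y n → Y n ≡ true → spacersBelow Y (suc n) ≡ spacersBelow Y n
spacersBelow-bead Y n e rewrite e = refl

spacersBelow-spacer : ∀ Y n → Y n ≡ false → spacersBelow Y (suc n) ≡ suc (spacersBelow Y n)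
spacersBelow-spacer Y n e rewrite e = refl

beadParts-bead : ∀ Y n → Y n ≡ true → beadParts Y (suc n) ≡ spacersBelow Y n ∷ beadParts Y n
beadParts-bead Y n e rewrite e = refl

beadParts-spacer : ∀ Y n → Y n ≡ false → beadParts Y (suc n) ≡ beadParts Y n
beadParts-spacer Y n e rewrite e = refl

record SameRows (p q : List ℕ) : Set where
  constructor sameRows
  field sameRow : ∀ r → row p r ≡ row q r
open SameRows

row-zeros : ∀ {p} → All (_≡ 0) p → ∀ r → row p r ≡ 0
row-zeros []         r       = refl
row-zeros (refl ∷ a) zero    = refl
row-zeros (refl ∷ a) (suc r) = row-zeros a r

sum-zeros : ∀ {p} → All (_≡ 0) p → sum p ≡ 0
sum-zeros []         = refl
sum-zeros (refl ∷ a) = sum-zeros a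

spacersBelow≡0 : ∀ Y n → spacersBelow Y n ≡ 0 → partitionOf Y n ≡ [] × All (_≡ 0) (beadParts Y n)
spacersBelow≡0 Y zero    e = refl , []
spacersBelow≡0 Y (suc n) e rewrite partitionOf-suc Y n with Y n | spacersBelow Y n in c≡0
... | true  | zero = let (p≡[] , zeros) = spacersBelow≡0 Y n c≡0 in p≡[] , refl ∷ zeros
... | false | _    with () ← e

partitionOf≈beadParts : ∀ Y n → SameRows (partitionOf Y n) (beadParts Y n) × sum (partitionOf Y n) ≡ sum (beadParts Y n)
partitionOf≈beadParts Y zero = sameRows (λ r → refl) , refl
partitionOf≈beadParts Y (suc n) rewrite partitionOf-suc Y n with Y n | spacersBelow Y n in c≡
... | false | c     = partitionOf≈beadParts Y n
... | true  | zero  = let (p≡[] , zeros) = spacersBelow≡0 Y n c≡ in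
  sameRows (λ r → trans (cong (λ p → row p r) p≡[]) (sym (row-zeros (refl ∷ zeros) r))) ,
  trans (cong sum p≡[]) (sym (sum-zeros (refl ∷ zeros)))
... | true  | suc c = let (rows , total) = partitionOf≈beadParts Y n in
  sameRows (λ { zero → refl ; (suc r) → sameRow rows r }) , cong (suc c +_) total

spacersBelow-mono : ∀ Y {m n} → m ≤′ n → spacersBelow Y m ≤ spacersBelow Y n
spacersBelow-mono Y ≤′-refl       = ≤-refl
spacersBelow-mono Y (≤′-step m≤n) = ≤-trans (spacersBelow-mono Y m≤n) (countSpacer-≥ _ _)

spacersBelow-allBeads : ∀ Y n → (∀ z → z < n → Y z ≡ true) → spacersBelow Y n ≡ 0
spacersBelow-allBeads Y zero    beads = refl
spacersBelow-allBeads Y (suc n) beads =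
  trans (spacersBelow-bead Y n (beads n ≤-refl)) (spacersBelow-allBeads Y n (λ z z<n → beads z (m<n⇒m<1+n z<n)))

partitionOf-downClosed : ∀ Y N → (∀ n → Y n ≡ true → ∀ z → z < n → Y z ≡ true) → partitionOf Y N ≡ []
partitionOf-downClosed Y zero    closed = refl
partitionOf-downClosed Y (suc n) closed = begin
  partitionOf Y (suc n)                              ≡⟨ partitionOf-suc Y n ⟩
  addPart (Y n) (spacersBelow Y n) (partitionOf Y n) ≡⟨ no-new-part ⟩
  partitionOf Y n                                    ≡⟨ partitionOf-downClosed Y n closed ⟩
  []                                                 ∎
  where
    open ≡-Reasoning
    no-new-part : addPart (Y n) (spacersBelow Y n) (partitionOf Y n) ≡ partitionOf Y n
    no-new-part with Y n in Yn
    ... | false = refl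
    ... | true rewrite spacersBelow-allBeads Y n (closed n Yn) = refl

spacersBelow-dropBead : ∀ Y → Y 0 ≡ true → ∀ n → spacersBelow Y (suc n) ≡ spacersBelow (Y ∘ suc) n
spacersBelow-dropBead Y Y0 zero    = spacersBelow-bead Y 0 Y0
spacersBelow-dropBead Y Y0 (suc n) = cong (countSpacer (Y (suc n))) (spacersBelow-dropBead Y Y0 n)

spacersBelow-dropSpacer : ∀ Y → Y 0 ≡ false → ∀ n → spacersBelow Y (suc n) ≡ suc (spacersBelow (Y ∘ suc) n)
spacersBelow-dropSpacer Y Y0 zero    = spacersBelow-spacer Y 0 Y0
spacersBelow-dropSpacer Y Y0 (suc n) with Y (suc n)
... | true  = spacersBelow-dropSpacer Y Y0 n
... | false = cong suc (spacersBelow-dropSpacer Y Y0 n)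

partitionOf-dropBead : ∀ Y → Y 0 ≡ true → ∀ n → partitionOf Y (suc n) ≡ partitionOf (Y ∘ suc) n
partitionOf-dropBead Y Y0 zero    = trans (partitionOf-suc Y 0) (cong (λ b → addPart b 0 []) Y0)
partitionOf-dropBead Y Y0 (suc n) = begin
  partitionOf Y (suc (suc n))                                                  ≡⟨ partitionOf-suc Y (suc n) ⟩
  addPart (Y (suc n)) (spacersBelow Y (suc n)) (partitionOf Y (suc n))         ≡⟨ cong₂ (addPart (Y (suc n)))
                                                                                   (spacersBelow-dropBead Y Y0 n)
                                                                                   (partitionOf-dropBead Y Y0 n) ⟩
  addPart (Y (suc n)) (spacersBelow (Y ∘ suc) n) (partitionOf (Y ∘ suc) n)     ≡⟨ partitionOf-suc (Y ∘ suc) n ⟨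
  partitionOf (Y ∘ suc) (suc n)                                                ∎
  where open ≡-Reasoning

beadParts-dropBead : ∀ Y → Y 0 ≡ true → ∀ n → beadParts Y (suc n) ≡ beadParts (Y ∘ suc) n ∷ʳ 0
beadParts-dropBead Y Y0 zero    = beadParts-bead Y 0 Y0
beadParts-dropBead Y Y0 (suc n) with Y (suc n)
... | true  = cong₂ _∷_ (spacersBelow-dropBead Y Y0 n) (beadParts-dropBead Y Y0 n)
... | false = beadParts-dropBead Y Y0 n

beadParts-dropSpacer : ∀ Y → Y 0 ≡ false → ∀ n → beadParts Y (suc n) ≡ map suc (beadParts (Y ∘ suc) n)
beadParts-dropSpacer Y Y0 zero    = beadParts-spacer Y 0 Y0
beadParts-dropSpacer Y Y0 (suc n) with Y (suc n)
... | true  = cong₂ _∷_ (spacersBelow-dropSpacer Y Y0 n) (beadParts-dropSpacer Y Y0 n)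
... | false = beadParts-dropSpacer Y Y0 n

beadParts-noBeads : ∀ Y → (∀ z → Y z ≡ false) → ∀ n → beadParts Y n ≡ []
beadParts-noBeads Y none zero    = refl
beadParts-noBeads Y none (suc n) = trans (beadParts-spacer Y n (none n)) (beadParts-noBeads Y none n)

partitionOf≡beadParts : ∀ Y → Y 0 ≡ false → ∀ n → partitionOf Y n ≡ beadParts Y n
partitionOf≡beadParts Y Y0 zero          = refl
partitionOf≡beadParts Y Y0 (suc zero)    =
  trans (partitionOf-suc Y 0) (trans (cong (λ b → addPart b 0 []) Y0) (sym (beadParts-spacer Y 0 Y0)))
partitionOf≡beadParts Y Y0 (suc (suc n)) with partitionOf≡beadParts Y Y0 (suc n) | Y (suc n) in Yn
... | ih | true = begin
  partitionOf Y (suc (suc n))                    ≡⟨ partitionOf-suc Y (suc n) ⟩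
  addPart (Y (suc n)) (spacersBelow Y (suc n)) p ≡⟨ cong₂ (λ b c → addPart b c p) Yn c≡ ⟩
  suc c ∷ p                                      ≡⟨ cong₂ _∷_ (sym c≡) ih ⟩
  spacersBelow Y (suc n) ∷ beadParts Y (suc n)   ∎
  where
    open ≡-Reasoning
    p = partitionOf Y (suc n)
    c = spacersBelow (Y ∘ suc) n
    c≡ = spacersBelow-dropSpacer Y Y0 n
... | ih | false = begin
  partitionOf Y (suc (suc n))                    ≡⟨ partitionOf-suc Y (suc n) ⟩
  addPart (Y (suc n)) (spacersBelow Y (suc n)) p ≡⟨ cong (λ b → addPart b (spacersBelow Y (suc n)) p) Yn ⟩
  p                                              ≡⟨ ih ⟩
  beadParts Y (suc n)                            ∎
  where
    open ≡-Reasoning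
    p = partitionOf Y (suc n)

-- Rim hooks

module _ {λ′ μ : Partition} where

  Conn-trans : ∀ {x y z} → Conn λ′ μ x y → Conn λ′ μ y z → Conn λ′ μ x z
  Conn-trans here        q = q
  Conn-trans (right a p) q = right a (Conn-trans p q)
  Conn-trans (left a p)  q = left a (Conn-trans p q)
  Conn-trans (down a p)  q = down a (Conn-trans p q)
  Conn-trans (up a p)    q = up a (Conn-trans p q)

  Conn-sym : ∀ {x y} → InSkew λ′ μ x → Conn λ′ μ x y → Conn λ′ μ y x
  Conn-sym x∈ here        = here
  Conn-sym x∈ (right a p) = Conn-trans (Conn-sym a p) (left x∈ here)
  Conn-sym x∈ (left a p)  = Conn-trans (Conn-sym a p) (right x∈ here)
  Conn-sym x∈ (down a p)  = Conn-trans (Conn-sym a p) (up x∈ here)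
  Conn-sym x∈ (up a p)    = Conn-trans (Conn-sym a p) (down x∈ here)

  Conn-along : ∀ r {c e} → row μ r ≤ c → c ≤′ e → e < row λ′ r → Conn λ′ μ (r , c) (r , e)
  Conn-along r μ≤c ≤′-refl         e<λ = here
  Conn-along r μ≤c (≤′-step c≤′e) e<λ =
    Conn-trans (Conn-along r μ≤c c≤′e (<⇒≤ e<λ))
               (right (e<λ , ≤⇒≯ (m≤n⇒m≤1+n (≤-trans μ≤c (≤′⇒≤ c≤′e)))) here)

  Conn-toRowEnd : ∀ {r c} → InSkew λ′ μ (r , c) → Conn λ′ μ (r , c) (r , pred (row λ′ r))
  Conn-toRowEnd {r} (c<λ , c≮μ) =
    Conn-along r (≮⇒≥ c≮μ) (≤⇒≤′ (suc[m]≤n⇒m≤pred[n] c<λ)) (pred< c<λ)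
    where
      pred< : ∀ {c n} → c < n → pred n < n
      pred< {n = suc n} _ = ≤-refl

shiftDown : Cell → Cell
shiftDown (r , c) = suc r , c

Conn-shiftDown : ∀ {λ′ μ a b x y} → Conn λ′ μ x y → Conn (a ∷ λ′) (b ∷ μ) (shiftDown x) (shiftDown y)
Conn-shiftDown here        = here
Conn-shiftDown (right p q) = right p (Conn-shiftDown q)
Conn-shiftDown (left p q)  = left p (Conn-shiftDown q)
Conn-shiftDown (down p q)  = down p (Conn-shiftDown q)
Conn-shiftDown (up p q)    = up p (Conn-shiftDown q)

module _ {λ₁ μ₁ λ₂ μ₂ : Partition} (sameλ : SameRows λ₁ λ₂) (sameμ : SameRows μ₁ μ₂) where

  InSkew-transport : ∀ {x} → InSkew λ₁ μ₁ x → InSkew λ₂ μ₂ x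
  InSkew-transport {r , c} (c<λ , c≮μ) =
    subst (c <_) (sameRow sameλ r) c<λ , λ c<μ → c≮μ (subst (c <_) (sym (sameRow sameμ r)) c<μ)

  Conn-transport : ∀ {x y} → Conn λ₁ μ₁ x y → Conn λ₂ μ₂ x y
  Conn-transport here        = here
  Conn-transport (right p q) = right (InSkew-transport p) (Conn-transport q)
  Conn-transport (left p q)  = left (InSkew-transport p) (Conn-transport q)
  Conn-transport (down p q)  = down (InSkew-transport p) (Conn-transport q)
  Conn-transport (up p q)    = up (InSkew-transport p) (Conn-transport q)

-- Connectivity is witnessed by paths into one hub cell; paths between any two cells then
-- follow by symmetry.
record HubbedStrip (λ′ μ : Partition) (hub : Cell) : Set where
  field
    rows≤ : ∀ r → row μ r ≤ row λ′ r
    hub∈  : InSkew λ′ μ hub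
    toHub : ∀ x → InSkew λ′ μ x → Conn λ′ μ x hub
    no2×2 : ∀ r c → InSkew λ′ μ (r , c) → InSkew λ′ μ (suc r , c)
          → InSkew λ′ μ (r , suc c) → InSkew λ′ μ (suc r , suc c) → ⊥
open HubbedStrip

strip-prepend : ∀ {λ′ μ h} a → HubbedStrip λ′ μ h → HubbedStrip (a ∷ λ′) (a ∷ μ) (shiftDown h)
strip-prepend a H .rows≤ zero                  = ≤-refl
strip-prepend a H .rows≤ (suc r)               = H .rows≤ r
strip-prepend a H .hub∈                        = H .hub∈
strip-prepend a H .toHub (zero , c)  (p , q)   = ⊥-elim (q p)
strip-prepend a H .toHub (suc r , c) s         = Conn-shiftDown (H .toHub (r , c) s)
strip-prepend a H .no2×2 zero c (p , q) _ _ _  = q p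
strip-prepend a H .no2×2 (suc r) c             = H .no2×2 r c

lastCell∈ : ∀ {x c} → c < suc x → x < suc x × ¬ x < c
lastCell∈ c≤x = ≤-refl , ≤⇒≯ (≤-pred c≤x)

strip-oneRow : ∀ {x c} T → c < suc x → HubbedStrip (suc x ∷ T) (c ∷ T) (0 , x)
strip-oneRow T c<x .rows≤ zero                = <⇒≤ c<x
strip-oneRow T c<x .rows≤ (suc r)             = ≤-refl
strip-oneRow T c<x .hub∈                      = lastCell∈ c<x
strip-oneRow T c<x .toHub (zero , j) s        = Conn-toRowEnd s
strip-oneRow T c<x .toHub (suc r , j) (p , q) = ⊥-elim (q p)
strip-oneRow T c<x .no2×2 r c _ (p , q) _ _   = q p

-- Cells below reach the new hub through the old hub (1 , m) and the cell (0 , m) above it.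
strip-extend : ∀ {x m L μ₁} → m ≤ x → HubbedStrip (suc m ∷ L) μ₁ (0 , m)
             → HubbedStrip (suc x ∷ suc m ∷ L) (m ∷ μ₁) (0 , x)
strip-extend m≤x H .rows≤ zero          = m≤n⇒m≤1+n m≤x
strip-extend m≤x H .rows≤ (suc r)       = H .rows≤ r
strip-extend m≤x H .hub∈                = lastCell∈ (s≤s m≤x)
strip-extend m≤x H .toHub (zero , j) s  = Conn-toRowEnd s
strip-extend m≤x H .toHub (suc r , j) s =
  Conn-trans (Conn-shiftDown (H .toHub (r , j) s)) (up m∈ (Conn-toRowEnd m∈))
  where m∈ = s≤s m≤x , <-irrefl refl
strip-extend m≤x H .no2×2 zero c (_ , c≮m) _ _ (c+1<m+1 , _) = c≮m (≤-pred c+1<m+1)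
strip-extend m≤x H .no2×2 (suc r) c = H .no2×2 r c

-- In μ each row of x ∷ M shrinks to one less than the length of the row below it (the last
-- row to c), so consecutive rows of the strip overlap in exactly one column.
strip-block : ∀ {c} x M T → Linked (λ a b → b ≤ a) (x ∷ M) → All (c <_) (x ∷ M)
            → HubbedStrip (x ∷ M ++ T) (map pred M ++ c ∷ T) (0 , pred x)
strip-block (suc x) []          T _           (c<x ∷ [])        = strip-oneRow T c<x
strip-block (suc x) (suc m ∷ M) T (m≤x ∷ dec) (_ ∷ c<m ∷ c<M) =
  strip-extend (≤-pred m≤x) (strip-block (suc m) M T dec (c<m ∷ c<M))

hubbedStrip : ∀ {c} A x M T → Linked (λ a b → b ≤ a) (x ∷ M) → All (c <_) (x ∷ M)
            → Σ Cell (HubbedStrip (A ++ x ∷ M ++ T) (A ++ map pred M ++ c ∷ T))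
hubbedStrip []      x M T dec c< = (0 , pred x) , strip-block x M T dec c<
hubbedStrip (a ∷ A) x M T dec c< =
  let (h , H) = hubbedStrip A x M T dec c< in shiftDown h , strip-prepend a H

SameRows-sym : ∀ {p q} → SameRows p q → SameRows q p
SameRows-sym (sameRows e) = sameRows (λ r → sym (e r))

removeRimHook-fromStrip : ∀ {s λ′ μ λ₀ μ₀ h} → IsPartition μ → SameRows λ′ λ₀ → SameRows μ μ₀
                        → sum λ′ ≡ sum μ + s → HubbedStrip λ₀ μ₀ h → RemoveRimHook s λ′ μ
removeRimHook-fromStrip {λ′ = λ′} {μ} {λ₀} {μ₀} μ-part sameλ sameμ total H =
  μ-part ,
  (λ r → subst₂ _≤_ (sym (sameRow sameμ r)) (sym (sameRow sameλ r)) (H .rows≤ r)) ,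
  total ,
  (λ x y x∈ y∈ → Conn-transport (SameRows-sym sameλ) (SameRows-sym sameμ)
                   (Conn-trans (H .toHub x (to x∈)) (Conn-sym (to y∈) (H .toHub y (to y∈))))) ,
  (λ r c a b d e → H .no2×2 r c (to a) (to b) (to d) (to e))
  where
    to : ∀ {x} → InSkew λ′ μ x → InSkew λ₀ μ₀ x
    to = InSkew-transport sameλ sameμ

sum-map-pred : ∀ M → All (0 <_) M → sum (map pred M) + length M ≡ sum M
sum-map-pred []          []      = refl
sum-map-pred (suc m ∷ M) (_ ∷ a) = begin
  m + sum (map pred M) + suc (length M)   ≡⟨ +-suc _ _ ⟩
  suc (m + sum (map pred M) + length M)   ≡⟨ cong suc (+-assoc m _ _) ⟩
  suc (m + (sum (map pred M) + length M)) ≡⟨ cong (λ n → suc (m + n)) (sum-map-pred M a) ⟩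
  suc (m + sum M)                         ∎
  where open ≡-Reasoning

sum-strip : ∀ A x M T c t → All (0 <_) M → x + length M ≡ suc (t + c)
          → sum (A ++ x ∷ M ++ T) ≡ sum (A ++ map pred M ++ c ∷ T) + suc t
sum-strip A x M T c t pos size
  rewrite sum-++ A (x ∷ M ++ T) | sum-++ A (map pred M ++ c ∷ T)
        | sum-++ M T | sum-++ (map pred M) (c ∷ T) | sym (sum-map-pred M pos) = begin
  a + (x + (m + l + u))    ≡⟨ regroup₁ a x m l u ⟩
  a + m + u + (x + l)      ≡⟨ cong (a + m + u +_) size ⟩
  a + m + u + suc (t + c)  ≡⟨ regroup₂ a m u t c ⟩
  a + (m + (c + u)) + suc t ∎
  where
    open ≡-Reasoning
    a = sum A
    m = sum (map pred M)
    l = length M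
    u = sum T
    regroup₁ : ∀ a x m l u → a + (x + (m + l + u)) ≡ a + m + u + (x + l)
    regroup₁ = solve-∀
    regroup₂ : ∀ a m u t c → a + m + u + suc (t + c) ≡ a + (m + (c + u)) + suc t
    regroup₂ = solve-∀

empty-noRimHook : ∀ {t ν} → ¬ RemoveRimHook (suc t) [] ν
empty-noRimHook {t} {ν} (_ , _ , total , _) with () ← trans total (+-suc (sum ν) t)

-- Sliding a bead s places down

beadParts-sharedTop : ∀ {Y Y′} n → spacersBelow Y′ n ≡ spacersBelow Y n → (∀ j → Y′ (j + n) ≡ Y (j + n))
  → ∀ j → Σ (List ℕ) λ A → spacersBelow Y′ (j + n) ≡ spacersBelow Y (j + n)
                          × beadParts Y (j + n) ≡ A ++ beadParts Y n
                          × beadParts Y′ (j + n) ≡ A ++ beadParts Y′ n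
beadParts-sharedTop n base agree zero = [] , base , refl , refl
beadParts-sharedTop {Y} n base agree (suc j) with beadParts-sharedTop n base agree j
... | A , spacers≡ , before≡ , after≡ rewrite agree j | spacers≡ with Y (j + n)
...   | true  = spacersBelow Y (j + n) ∷ A , refl , cong (_ ∷_) before≡ , cong (_ ∷_) after≡
...   | false = A , refl , before≡ , after≡

module SlideBead (Y Y′ : ℕ → Bool) (b t : ℕ)
  (Yb : Y b ≡ false) (Yy : Y (suc (t + b)) ≡ true)
  (Y′b : Y′ b ≡ true) (Y′y : Y′ (suc (t + b)) ≡ false)
  (agree : ∀ z → z ≢ b → z ≢ suc (t + b) → Y′ z ≡ Y z) where

  y : ℕ
  y = suc (t + b)

  c : ℕ
  c = spacersBelow Y b

  T : List ℕ
  T = beadParts Y b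

  agreeBelow : ∀ n → n ≤ b → spacersBelow Y′ n ≡ spacersBelow Y n × beadParts Y′ n ≡ beadParts Y n
  agreeBelow zero    _   = refl , refl
  agreeBelow (suc n) n<b
    rewrite agree n (<⇒≢ n<b) (<⇒≢ (<-trans n<b (s≤s (m≤n+m b t))))
    with agreeBelow n (<⇒≤ n<b)
  ... | spacers≡ , parts≡ rewrite spacers≡ | parts≡ = refl , refl

  c<spacersBelow : ∀ n → b < n → c < spacersBelow Y n
  c<spacersBelow n b<n =
    ≤-trans (≤-reflexive (sym (cong (λ v → countSpacer v c) Yb))) (spacersBelow-mono Y (≤⇒≤′ b<n))

  agreeBetween : ∀ i → i < t → Y′ (suc (i + b)) ≡ Y (suc (i + b))
  agreeBetween i i<t = agree (suc (i + b)) (>⇒≢ (s≤s (m≤n+m b i))) (<⇒≢ (s≤s (+-monoˡ-< b i<t)))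

  -- After the bead at y moves to b, every bead strictly between them has one spacer fewer below it.
  record Window (i : ℕ) : Set where
    field
      parts      : List ℕ
      spacers≡   : spacersBelow Y (suc (i + b)) ≡ suc (spacersBelow Y′ (suc (i + b)))
      before≡    : beadParts Y (suc (i + b)) ≡ parts ++ T
      after≡     : beadParts Y′ (suc (i + b)) ≡ map pred parts ++ c ∷ T
      >c         : All (c <_) parts
      decreasing : Linked (λ a b → b ≤ a) parts
      ≤spacers   : All (_≤ spacersBelow Y (suc (i + b))) parts
      size       : spacersBelow Y (suc (i + b)) + length parts ≡ suc (i + c)

  window-step : ∀ i → i < t → Window i → Window (suc i)
  window-step i i<t W with Y (suc (i + b)) in Yp
  ... | false = record
    { parts      = parts
    ; spacers≡   = trans (spacersBelow-spacer Y p Yp) (cong suc (trans spacers≡ (sym (spacersBelow-spacer Y′ p Y′p))))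
    ; before≡    = trans (beadParts-spacer Y p Yp) before≡
    ; after≡     = trans (beadParts-spacer Y′ p Y′p) after≡
    ; >c         = >c
    ; decreasing = decreasing
    ; ≤spacers   = All-map (λ h → ≤-trans h (countSpacer-≥ (Y p) _)) ≤spacers
    ; size       = trans (cong (_+ length parts) (spacersBelow-spacer Y p Yp)) (cong suc size) }
    where
      open Window W
      p = suc (i + b)
      Y′p = trans (agreeBetween i i<t) Yp
  ... | true = record
    { parts      = d ∷ parts
    ; spacers≡   = trans (spacersBelow-bead Y p Yp) (trans spacers≡ (cong suc (sym (spacersBelow-bead Y′ p Y′p))))
    ; before≡    = trans (beadParts-bead Y p Yp) (cong (d ∷_) before≡)
    ; after≡     = trans (beadParts-bead Y′ p Y′p) (cong₂ _∷_ (cong pred (sym spacers≡)) after≡)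
    ; >c         = c<spacersBelow p (s≤s (m≤n+m b i)) ∷ >c
    ; decreasing = Linked-≥-∷ ≤spacers decreasing
    ; ≤spacers   = All-map (λ h → ≤-trans h (countSpacer-≥ (Y p) _)) (≤-refl ∷ ≤spacers)
    ; size       = trans (cong (_+ suc (length parts)) (spacersBelow-bead Y p Yp))
                         (trans (+-suc d (length parts)) (cong suc size)) }
    where
      open Window W
      p = suc (i + b)
      d = spacersBelow Y p
      Y′p = trans (agreeBetween i i<t) Yp

  window : ∀ i → i ≤ t → Window i
  window zero _ = record
    { parts      = []
    ; spacers≡   = trans (spacersBelow-spacer Y b Yb) (cong suc (sym (trans (spacersBelow-bead Y′ b Y′b) spacers≡)))
    ; before≡    = beadParts-spacer Y b Yb
    ; after≡     = trans (beadParts-bead Y′ b Y′b) (cong₂ _∷_ spacers≡ parts≡)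
    ; >c         = []
    ; decreasing = []
    ; ≤spacers   = []
    ; size       = trans (+-identityʳ _) (spacersBelow-spacer Y b Yb) }
    where
      spacers≡ = proj₁ (agreeBelow b ≤-refl)
      parts≡   = proj₂ (agreeBelow b ≤-refl)
  window (suc i) i<t = window-step i i<t (window i (<⇒≤ i<t))

  removesRimHook : ∀ N → y < N → RemoveRimHook (suc t) (partitionOf Y N) (partitionOf Y′ N)
  removesRimHook N y<N = subst (λ n → RemoveRimHook (suc t) (partitionOf Y n) (partitionOf Y′ n))
                               (m∸n+n≡m y<N) (removesRimHook-above (N ∸ suc y))
    where
      open Window (window t ≤-refl)
      x = spacersBelow Y y

      y<above : ∀ j → y < j + suc y
      y<above j = m≤n+m (suc y) j

      top = beadParts-sharedTop (suc y)
        (trans (spacersBelow-spacer Y′ y Y′y) (trans (sym spacers≡) (sym (spacersBelow-bead Y y Yy))))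
        (λ j → agree (j + suc y) (>⇒≢ (<-trans (s≤s (m≤n+m b t)) (y<above j))) (>⇒≢ (y<above j)))

      removesRimHook-above : ∀ j → RemoveRimHook (suc t) (partitionOf Y (j + suc y)) (partitionOf Y′ (j + suc y))
      removesRimHook-above j =
        removeRimHook-fromStrip (partitionOf-isPartition Y′ N′) sameλ sameμ total (proj₂ strip)
        where
          N′ = j + suc y
          A = proj₁ (top j)
          λ≡ : beadParts Y N′ ≡ A ++ x ∷ parts ++ T
          λ≡ = trans (proj₁ (proj₂ (proj₂ (top j))))
                     (cong (A ++_) (trans (beadParts-bead Y y Yy) (cong (x ∷_) before≡)))
          μ≡ : beadParts Y′ N′ ≡ A ++ map pred parts ++ c ∷ T
          μ≡ = trans (proj₂ (proj₂ (proj₂ (top j)))) (cong (A ++_) (trans (beadParts-spacer Y′ y Y′y) after≡))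
          strip = hubbedStrip A x parts T (Linked-≥-∷ ≤spacers decreasing)
                              (c<spacersBelow y (s≤s (m≤n+m b t)) ∷ >c)
          sameλ : SameRows (partitionOf Y N′) (A ++ x ∷ parts ++ T)
          sameλ = sameRows λ r → trans (sameRow (proj₁ (partitionOf≈beadParts Y N′)) r) (cong (λ p → row p r) λ≡)
          sameμ : SameRows (partitionOf Y′ N′) (A ++ map pred parts ++ c ∷ T)
          sameμ = sameRows λ r → trans (sameRow (proj₁ (partitionOf≈beadParts Y′ N′)) r) (cong (λ p → row p r) μ≡)
          total : sum (partitionOf Y N′) ≡ sum (partitionOf Y′ N′) + suc t
          total = begin
            sum (partitionOf Y N′)                     ≡⟨ proj₂ (partitionOf≈beadParts Y N′) ⟩
            sum (beadParts Y N′)                       ≡⟨ cong sum λ≡ ⟩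
            sum (A ++ x ∷ parts ++ T)                  ≡⟨ sum-strip A x parts T c t (All-map (≤-trans (s≤s z≤n)) >c) size ⟩
            sum (A ++ map pred parts ++ c ∷ T) + suc t ≡⟨ cong (λ p → sum p + suc t) μ≡ ⟨
            sum (beadParts Y′ N′) + suc t              ≡⟨ cong (_+ suc t) (proj₂ (partitionOf≈beadParts Y′ N′)) ⟨
            sum (partitionOf Y′ N′) + suc t            ∎
            where open ≡-Reasoning

-- Runners

beadAt : List Bool → ℕ → Bool
beadAt []      _       = false
beadAt (b ∷ _) zero    = b
beadAt (_ ∷ l) (suc j) = beadAt l j

data SlideDown : List Bool → List Bool → Set where
  here  : ∀ {l} → SlideDown (false ∷ true ∷ l) (true ∷ false ∷ l)
  there : ∀ {b l l′} → SlideDown l l′ → SlideDown (b ∷ l) (b ∷ l′)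

SlidesAt : List Bool → List Bool → ℕ → Set
SlidesAt l l′ j = beadAt l j ≡ false × beadAt l (suc j) ≡ true
                × beadAt l′ j ≡ true × beadAt l′ (suc j) ≡ false
                × (∀ i → i ≢ j → i ≢ suc j → beadAt l′ i ≡ beadAt l i)

slideDown-position : ∀ {l l′} → SlideDown l l′ → Σ ℕ (SlidesAt l l′)
slideDown-position here = 0 , refl , refl , refl , refl , elsewhere
  where
    elsewhere : ∀ i → i ≢ 0 → i ≢ 1 → _
    elsewhere zero          i≢0 _   = ⊥-elim (i≢0 refl)
    elsewhere (suc zero)    _   i≢1 = ⊥-elim (i≢1 refl)
    elsewhere (suc (suc i)) _   _   = refl
slideDown-position (there st) with slideDown-position st
... | j , a , b , c , d , e = suc j , a , b , c , d , elsewhere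
  where
    elsewhere : ∀ i → i ≢ suc j → i ≢ suc (suc j) → _
    elsewhere zero    _ _ = refl
    elsewhere (suc i) p q = e i (p ∘ cong suc) (q ∘ cong suc)

BeadsBelow : ℕ → List Bool → Set
BeadsBelow H l = ∀ i → beadAt l i ≡ true → i < H

slideDown-BeadsBelow : ∀ {H l l′} → SlideDown l l′ → BeadsBelow H l → BeadsBelow H l′
slideDown-BeadsBelow st below i bead with slideDown-position st
... | j , _ , bead-j+1 , _ , spacer-j+1′ , elsewhere with i ≟ j | i ≟ suc j
...   | yes refl | _        = <-trans (n<1+n i) (below (suc i) bead-j+1)
...   | no _     | yes refl with () ← trans (sym spacer-j+1′) bead
...   | no i≢j   | no i≢j+1 = below i (trans (sym (elsewhere i i≢j i≢j+1)) bead)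

SlideDown*-∷ : ∀ {b l l′} → Star SlideDown l l′ → Star SlideDown (b ∷ l) (b ∷ l′)
SlideDown*-∷ ε          = ε
SlideDown*-∷ (st ◅ sts) = there st ◅ SlideDown*-∷ sts

countBeads : List Bool → ℕ
countBeads []          = 0
countBeads (true ∷ l)  = suc (countBeads l)
countBeads (false ∷ l) = countBeads l

countSpacers : List Bool → ℕ
countSpacers []          = 0
countSpacers (true ∷ l)  = countSpacers l
countSpacers (false ∷ l) = suc (countSpacers l)

settle : List Bool → List Bool
settle l = replicate (countBeads l) true ++ replicate (countSpacers l) false

spacer-sinks : ∀ a l → Star SlideDown (false ∷ replicate a true ++ l) (replicate a true ++ false ∷ l)
spacer-sinks zero    l = ε
spacer-sinks (suc a) l = here ◅ SlideDown*-∷ (spacer-sinks a l)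

settle-reachable : ∀ l → Star SlideDown l (settle l)
settle-reachable []          = ε
settle-reachable (true ∷ l)  = SlideDown*-∷ (settle-reachable l)
settle-reachable (false ∷ l) =
  SlideDown*-∷ (settle-reachable l) ◅◅ spacer-sinks (countBeads l) (replicate (countSpacers l) false)

beadAt-replicate-true : ∀ a l j → j < a → beadAt (replicate a true ++ l) j ≡ true
beadAt-replicate-true (suc a) l zero    _         = refl
beadAt-replicate-true (suc a) l (suc j) (s≤s j<a) = beadAt-replicate-true a l j j<a

beadAt-replicate-+ : ∀ a l j → beadAt (replicate a true ++ l) (j + a) ≡ beadAt l j
beadAt-replicate-+ zero    l j = cong (beadAt l) (+-identityʳ j)
beadAt-replicate-+ (suc a) l j rewrite +-suc j a = beadAt-replicate-+ a l j

beadAt-settled : ∀ a b j → beadAt (replicate a true ++ replicate b false) j ≡ (j <ᵇ a)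
beadAt-settled zero    zero    j       = refl
beadAt-settled zero    (suc b) zero    = refl
beadAt-settled zero    (suc b) (suc j) = beadAt-settled zero b j
beadAt-settled (suc a) b       zero    = refl
beadAt-settled (suc a) b       (suc j) = beadAt-settled a b j

module Runners (t : ℕ) where

  s : ℕ
  s = suc t

  -- S r lists the beads of runner r, from row 0 upwards.
  beadsOf : (ℕ → List Bool) → ℕ → Bool
  beadsOf S z = beadAt (S (z % s)) (z / s)

  position-divMod : ∀ r j → r < s → (r + j * s) % s ≡ r × (r + j * s) / s ≡ j
  position-divMod r j r<s =
    trans ([m+kn]%n≡m%n r j s) (m<n⇒m%n≡m r<s) ,
    trans (+-distrib-/ r (j * s) no-carry) (cong₂ _+_ (m<n⇒m/n≡0 r<s) (m*n/n≡m j s))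
    where
      js%s≡0 : (j * s) % s ≡ 0
      js%s≡0 = [m+kn]%n≡m%n 0 j s
      no-carry : r % s + (j * s) % s < s
      no-carry rewrite m<n⇒m%n≡m r<s | js%s≡0 | +-identityʳ r = r<s

  beadsOf-position : ∀ S r j → r < s → beadsOf S (r + j * s) ≡ beadAt (S r) j
  beadsOf-position S r j r<s rewrite proj₁ (position-divMod r j r<s) | proj₂ (position-divMod r j r<s) = refl

  beadsOf-cong : ∀ {S S′} → (∀ r → S r ≡ S′ r) → ∀ z → beadsOf S z ≡ beadsOf S′ z
  beadsOf-cong e z = cong (λ l → beadAt l (z / s)) (e (z % s))

  next-row : ∀ r j → suc (t + (r + j * s)) ≡ r + suc j * s
  next-row r j = identity t r j
    where
      identity : ∀ t r j → suc (t + (r + j * suc t)) ≡ r + suc j * suc t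
      identity = solve-∀

  setRunner : (ℕ → List Bool) → ℕ → List Bool → ℕ → List Bool
  setRunner S r l x with x ≟ r
  ... | yes _ = l
  ... | no  _ = S x

  setRunner-same : ∀ S r l → setRunner S r l r ≡ l
  setRunner-same S r l with r ≟ r
  ... | yes _   = refl
  ... | no  r≢r = ⊥-elim (r≢r refl)

  setRunner-other : ∀ S r l x → x ≢ r → setRunner S r l x ≡ S x
  setRunner-other S r l x x≢r with x ≟ r
  ... | yes x≡r = ⊥-elim (x≢r x≡r)
  ... | no  _   = refl

  setRunner-agree : ∀ S r {l l′} j → r < s → (∀ i → i ≢ j → i ≢ suc j → beadAt l′ i ≡ beadAt l i)
    → ∀ z → z ≢ r + j * s → z ≢ r + suc j * s → beadsOf (setRunner S r l′) z ≡ beadsOf (setRunner S r l) z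
  setRunner-agree S r {l} {l′} j r<s elsewhere z z≢rj z≢rj+1 = agreeOn (z % s ≟ r)
    where
      agreeOn : Dec (z % s ≡ r) → beadsOf (setRunner S r l′) z ≡ beadsOf (setRunner S r l) z
      agreeOn (no z%s≢r) = cong (λ w → beadAt w (z / s))
        (trans (setRunner-other S r l′ (z % s) z%s≢r) (sym (setRunner-other S r l (z % s) z%s≢r)))
      agreeOn (yes z%s≡r) = begin
        beadAt (setRunner S r l′ (z % s)) (z / s) ≡⟨ cong (λ x → beadAt (setRunner S r l′ x) (z / s)) z%s≡r ⟩
        beadAt (setRunner S r l′ r) (z / s)       ≡⟨ cong (λ w → beadAt w (z / s)) (setRunner-same S r l′) ⟩
        beadAt l′ (z / s)                         ≡⟨ elsewhere (z / s) (z≢rj ∘ onRow j) (z≢rj+1 ∘ onRow (suc j)) ⟩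
        beadAt l (z / s)                          ≡⟨ cong (λ w → beadAt w (z / s)) (setRunner-same S r l) ⟨
        beadAt (setRunner S r l r) (z / s)        ≡⟨ cong (λ x → beadAt (setRunner S r l x) (z / s)) z%s≡r ⟨
        beadAt (setRunner S r l (z % s)) (z / s)  ∎
        where
          open ≡-Reasoning
          onRow : ∀ i → z / s ≡ i → z ≡ r + i * s
          onRow i e = trans (m≡m%n+[m/n]*n z s) (cong₂ (λ u v → u + v * s) z%s≡r e)

  slideDown-removesRimHook : ∀ S r {l l′} H N → r < s → SlideDown l l′ → BeadsBelow H l → H * s ≤ N
    → RemoveRimHook s (partitionOf (beadsOf (setRunner S r l)) N) (partitionOf (beadsOf (setRunner S r l′)) N)
  slideDown-removesRimHook S r {l} {l′} H N r<s st below HsN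
    with j , spacer-j , bead-j+1 , bead-j′ , spacer-j+1′ , elsewhere ← slideDown-position st =
    SlideBead.removesRimHook Y Y′ b t
      (trans (at l j) spacer-j) (trans (cong Y (next-row r j)) (trans (at l (suc j)) bead-j+1))
      (trans (at l′ j) bead-j′) (trans (cong Y′ (next-row r j)) (trans (at l′ (suc j)) spacer-j+1′))
      (λ z z≢b z≢y → setRunner-agree S r j r<s elsewhere z z≢b (λ e → z≢y (trans e (sym (next-row r j)))))
      N y<N
    where
      Y = beadsOf (setRunner S r l)
      Y′ = beadsOf (setRunner S r l′)
      b = r + j * s

      at : ∀ l″ i → beadsOf (setRunner S r l″) (r + i * s) ≡ beadAt l″ i
      at l″ i = trans (beadsOf-position (setRunner S r l″) r i r<s) (cong (λ w → beadAt w i) (setRunner-same S r l″))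

      y<N : suc (t + b) < N
      y<N = ≤-trans (subst (λ w → suc w ≤ suc (suc j) * s) (sym (next-row r j)) (+-monoˡ-< (suc j * s) r<s))
                    (≤-trans (*-monoˡ-≤ s (below (suc j) bead-j+1)) HsN)

  slideDown*-removesRimHooks : ∀ S r {l l′} H N → r < s → Star SlideDown l l′ → BeadsBelow H l → H * s ≤ N
    → Star (RemoveRimHook s) (partitionOf (beadsOf (setRunner S r l)) N) (partitionOf (beadsOf (setRunner S r l′)) N)
  slideDown*-removesRimHooks S r H N r<s ε          below HsN = ε
  slideDown*-removesRimHooks S r H N r<s (st ◅ sts) below HsN =
    slideDown-removesRimHook S r H N r<s st below HsN ◅
    slideDown*-removesRimHooks S r H N r<s sts (slideDown-BeadsBelow st below) HsN

  settleFirst : (ℕ → List Bool) → ℕ → ℕ → List Bool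
  settleFirst S p x with x <? p
  ... | yes _ = settle (S x)
  ... | no  _ = S x

  settleFirst-before : ∀ S p x → setRunner (settleFirst S p) p (S p) x ≡ settleFirst S p x
  settleFirst-before S p x with x ≟ p
  ... | no  _    = refl
  ... | yes refl with x <? x
  ...   | no  _   = refl
  ...   | yes x<x = ⊥-elim (<-irrefl refl x<x)

  settleFirst-after : ∀ S p x → setRunner (settleFirst S p) p (settle (S p)) x ≡ settleFirst S (suc p) x
  settleFirst-after S p x with x ≟ p
  ... | yes refl with x <? suc x
  ...   | yes _     = refl
  ...   | no  x≮x+1 = ⊥-elim (x≮x+1 ≤-refl)
  settleFirst-after S p x | no x≢p with x <? p | x <? suc p
  ... | yes _   | yes _     = refl
  ... | no  _   | no  _     = refl
  ... | yes x<p | no  x≮p+1 = ⊥-elim (x≮p+1 (m<n⇒m<1+n x<p))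
  ... | no  x≮p | yes x<p+1 = ⊥-elim (x≮p (≤∧≢⇒< (≤-pred x<p+1) x≢p))

  settleFirst-removesRimHooks : ∀ S H N → H * s ≤ N → (∀ r → r < s → BeadsBelow H (S r))
    → ∀ p → p ≤ s → Star (RemoveRimHook s) (partitionOf (beadsOf S) N) (partitionOf (beadsOf (settleFirst S p)) N)
  settleFirst-removesRimHooks S H N HsN below zero    _     = ε
  settleFirst-removesRimHooks S H N HsN below (suc p) p<s =
    settleFirst-removesRimHooks S H N HsN below p (<⇒≤ p<s) ◅◅
    subst₂ (Star (RemoveRimHook s))
      (partitionOf-cong (beadsOf-cong (settleFirst-before S p)) N)
      (partitionOf-cong (beadsOf-cong (settleFirst-after S p)) N)
      (slideDown*-removesRimHooks (settleFirst S p) p H N p<s (settle-reachable (S p)) (below p p<s) HsN)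

  settled-empty : ∀ S N c → (∀ r → r < s → countBeads (S r) ≡ c) → partitionOf (beadsOf (settleFirst S s)) N ≡ []
  settled-empty S N c count = partitionOf-downClosed _ N closed
    where
      below-row : ∀ z → beadsOf (settleFirst S s) z ≡ (z / s <ᵇ c)
      below-row z with z % s <? s
      ... | yes r<s = trans (beadAt-settled (countBeads (S (z % s))) _ (z / s)) (cong (z / s <ᵇ_) (count (z % s) r<s))
      ... | no  r≮s = ⊥-elim (r≮s (m%n<n z s))
      closed : ∀ n → beadsOf (settleFirst S s) n ≡ true → ∀ z → z < n → beadsOf (settleFirst S s) z ≡ true
      closed n bead z z<n = trans (below-row z) (<⇒<ᵇ≡true
        (≤-<-trans (/-monoˡ-≤ s (<⇒≤ z<n)) (<ᵇ≡true⇒< (n / s) c (trans (sym (below-row n)) bead))))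

-- The abacus α(2k)

partitionOf-dropBeads : ∀ i v n → partitionOf (beadAt (replicate i true ++ v)) (i + n) ≡ partitionOf (beadAt v) n
partitionOf-dropBeads zero    v n = refl
partitionOf-dropBeads (suc i) v n =
  trans (partitionOf-dropBead (beadAt (replicate (suc i) true ++ v)) refl (i + n)) (partitionOf-dropBeads i v n)

alternating : ℕ → List Bool
alternating zero    = []
alternating (suc m) = true ∷ false ∷ alternating m

runnerContent : ℕ → ℕ → List Bool
runnerContent i m = replicate i true ++ false ∷ alternating m

countBeads-runnerContent : ∀ i m → countBeads (runnerContent i m) ≡ i + m
countBeads-runnerContent (suc i) m = cong suc (countBeads-runnerContent i m)
countBeads-runnerContent zero    m = alt m
  where
    alt : ∀ m → countBeads (alternating m) ≡ m
    alt zero    = refl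
    alt (suc m) = cong suc (alt m)

tau-suc : ∀ m → tau (suc m) ≡ map suc (tau m ∷ʳ 0)
tau-suc m = cong (map suc) (sym (trans (cong (_∷ʳ 0) (map-downFrom suc m)) (downFrom-∷ʳ m)))

beadParts-alternating : ∀ m n → length (false ∷ alternating m) ≤ n
                      → beadParts (beadAt (false ∷ alternating m)) n ≡ tau m
beadParts-alternating zero (suc n) _ =
  trans (beadParts-dropSpacer (beadAt (false ∷ [])) refl n)
        (cong (map suc) (beadParts-noBeads (beadAt []) (λ _ → refl) n))
beadParts-alternating (suc m) (suc (suc n)) (s≤s (s≤s len≤n)) = begin
  beadParts (beadAt X) (suc (suc n))               ≡⟨ beadParts-dropSpacer (beadAt X) refl (suc n) ⟩
  map suc (beadParts (beadAt (true ∷ X′)) (suc n)) ≡⟨ cong (map suc) (beadParts-dropBead (beadAt (true ∷ X′)) refl n) ⟩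
  map suc (beadParts (beadAt X′) n ∷ʳ 0)           ≡⟨ cong (λ p → map suc (p ∷ʳ 0)) (beadParts-alternating m n len≤n) ⟩
  map suc (tau m ∷ʳ 0)                             ≡⟨ tau-suc m ⟨
  tau (suc m)                                      ∎
  where
    open ≡-Reasoning
    X  = false ∷ alternating (suc m)
    X′ = false ∷ alternating m

partitionOf-runnerContent : ∀ i m n → length (false ∷ alternating m) ≤ n
  → partitionOf (beadAt (runnerContent i m)) (i + n) ≡ tau m
partitionOf-runnerContent i m n len≤n = begin
  partitionOf (beadAt (runnerContent i m)) (i + n)     ≡⟨ partitionOf-dropBeads i (false ∷ alternating m) n ⟩
  partitionOf (beadAt (false ∷ alternating m)) n       ≡⟨ partitionOf≡beadParts (beadAt (false ∷ alternating m)) refl n ⟩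
  beadParts (beadAt (false ∷ alternating m)) n         ≡⟨ beadParts-alternating m n len≤n ⟩
  tau m                                                ∎
  where open ≡-Reasoning

odd?⇒>0 : ∀ w → odd? w ≡ true → 0 < w
odd?⇒>0 (suc w) _ = s≤s z≤n

beadAt-alternating : ∀ m w → beadAt (false ∷ alternating m) w ≡ odd? w ∧ (w <ᵇ 2 * m)
beadAt-alternating zero    zero    = refl
beadAt-alternating zero    (suc w) = sym (∧-zeroʳ (odd? (suc w)))
beadAt-alternating (suc m) w rewrite *-suc 2 m with w
... | zero          = refl
... | suc zero      = refl
... | suc (suc w′)  = beadAt-alternating m w′

w<2m⇒w+i<2[m+i] : ∀ {w m i} → w < 2 * m → w + i < 2 * (m + i)
w<2m⇒w+i<2[m+i] {w} {m} {i} w<2m = begin-strict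
  w + i           <⟨ +-monoˡ-< i w<2m ⟩
  2 * m + i       ≤⟨ +-monoʳ-≤ (2 * m) (m≤n*m i 2) ⟩
  2 * m + 2 * i   ≡⟨ *-distribˡ-+ 2 m i ⟨
  2 * (m + i)     ∎
  where open ≤-Reasoning

runnerBead-above : ∀ i m w → runnerBead (suc (m + i)) i (w + i)
                 ≡ (w + i <ᵇ 2 * (m + i)) ∧ ((i <ᵇ w + i) ∧ (odd? w ∧ (w <ᵇ 2 * m)))
runnerBead-above i m w =
  cong₂ _∧_ (cong (λ n → w + i <ᵇ n ∸ 2) (*-suc 2 (m + i)))
            (cong₂ _∨_ (≮⇒<ᵇ≡false (m+n≮n w i))
                       (cong₂ (λ o l → (i <ᵇ w + i) ∧ (odd? o ∧ l)) (m+n∸n≡m w i)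
                              (cong₂ (λ u v → u <ᵇ 2 * v) (m+n∸n≡m w i) (m+n∸n≡m m i))))

beadAt-runnerContent-above : ∀ i m w → beadAt (runnerContent i m) (w + i) ≡ runnerBead (suc (m + i)) i (w + i)
beadAt-runnerContent-above i m w = begin
  beadAt (runnerContent i m) (w + i)                          ≡⟨ beadAt-replicate-+ i (false ∷ alternating m) w ⟩
  beadAt (false ∷ alternating m) w                            ≡⟨ beadAt-alternating m w ⟩
  b                                                           ≡⟨ ∧-redundantˡ above-i ⟨
  (i <ᵇ w + i) ∧ b                                            ≡⟨ ∧-redundantˡ below-bound ⟨
  (w + i <ᵇ 2 * (m + i)) ∧ ((i <ᵇ w + i) ∧ b)                 ≡⟨ runnerBead-above i m w ⟨
  runnerBead (suc (m + i)) i (w + i)                          ∎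
  where
    open ≡-Reasoning
    b = odd? w ∧ (w <ᵇ 2 * m)
    above-i : b ≡ true → (i <ᵇ w + i) ≡ true
    above-i b≡ = <⇒<ᵇ≡true (m<n+m i (odd?⇒>0 w (proj₁ (∧≡true b≡))))
    below-bound : (i <ᵇ w + i) ∧ b ≡ true → (w + i <ᵇ 2 * (m + i)) ≡ true
    below-bound b≡ = <⇒<ᵇ≡true (w<2m⇒w+i<2[m+i] {w} {m} {i}
      (<ᵇ≡true⇒< w (2 * m) (proj₂ (∧≡true {odd? w} (proj₂ (∧≡true {i <ᵇ w + i} b≡))))))

length-alternating : ∀ m → length (alternating m) ≡ 2 * m
length-alternating zero    = refl
length-alternating (suc m) = trans (cong (2 +_) (length-alternating m)) (sym (*-suc 2 m))

runnerContent-fits : ∀ i m → length (false ∷ alternating m) + i ≤ 2 * suc (m + i)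
runnerContent-fits i m =
  subst₂ _≤_ (cong (λ l → suc l + i) (sym (length-alternating m))) (sym (split i m)) (m≤m+n _ (suc i))
  where
    split : ∀ i m → 2 * suc (m + i) ≡ suc (2 * m) + i + suc i
    split = solve-∀

beadAt-runnerContent : ∀ i m j → beadAt (runnerContent i m) j ≡ runnerBead (suc (m + i)) i j
beadAt-runnerContent i m j with j <? i
... | yes j<i = begin
  beadAt (runnerContent i m) j                               ≡⟨ beadAt-replicate-true i _ j j<i ⟩
  true                                                       ≡⟨ <⇒<ᵇ≡true j<2[m+i] ⟨
  (j <ᵇ 2 * (m + i))                                         ≡⟨ cong (λ n → j <ᵇ n ∸ 2) (*-suc 2 (m + i)) ⟨
  (j <ᵇ 2 * suc (m + i) ∸ 2)                                 ≡⟨ ∧-identityʳ _ ⟨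
  (j <ᵇ 2 * suc (m + i) ∸ 2) ∧ true                          ≡⟨ cong (λ b → bound ∧ (b ∨ rest)) (<⇒<ᵇ≡true j<i) ⟨
  runnerBead (suc (m + i)) i j                               ∎
  where
    open ≡-Reasoning
    bound = j <ᵇ 2 * suc (m + i) ∸ 2
    rest = (i <ᵇ j) ∧ odd? (j ∸ i) ∧ (j ∸ i <ᵇ 2 * (suc (m + i) ∸ 1 ∸ i))
    j<2[m+i] : j < 2 * (m + i)
    j<2[m+i] = <-≤-trans j<i (≤-trans (m≤n+m i m) (m≤n*m (m + i) 2))
... | no j≮i = subst (λ j → beadAt (runnerContent i m) j ≡ runnerBead (suc (m + i)) i j)
                     (m∸n+n≡m (≮⇒≥ j≮i)) (beadAt-runnerContent-above i m (j ∸ i))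

foldIndex : ℕ → ℕ → ℕ
foldIndex k r = if r <ᵇ k then r else 2 * k ∸ 1 ∸ r

alphaRunner : ℕ → ℕ → List Bool
alphaRunner k r = runnerContent (foldIndex k r) (k ∸ 1 ∸ foldIndex k r)

module Alpha (K : ℕ) where

  k : ℕ
  k = suc K

  open Runners (pred (2 * k))

  2k∸1≡K+k : 2 * k ∸ 1 ≡ K + k
  2k∸1≡K+k = cong (K +_) (+-identityʳ k)

  foldIndex<k : ∀ r → foldIndex k r < k
  foldIndex<k r with r <ᵇ k in r<?k
  ... | true  = <ᵇ≡true⇒< r k r<?k
  ... | false = s≤s (begin
    2 * k ∸ 1 ∸ r  ≤⟨ ∸-monoʳ-≤ (2 * k ∸ 1) (≮⇒≥ (<ᵇ≡false⇒≮ {r} {k} r<?k)) ⟩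
    2 * k ∸ 1 ∸ k  ≡⟨ cong (_∸ k) 2k∸1≡K+k ⟩
    K + k ∸ k      ≡⟨ m+n∸n≡m K k ⟩
    K              ∎)
    where open ≤-Reasoning

  foldIndex-low : ∀ i → i < k → foldIndex k i ≡ i
  foldIndex-low i i<k rewrite <⇒<ᵇ≡true i<k = refl

  mirror≥k : ∀ i → i < k → k ≤ 2 * k ∸ 1 ∸ i
  mirror≥k i i<k = begin
    k              ≡⟨ m+n∸m≡n K k ⟨
    K + k ∸ K      ≤⟨ ∸-monoʳ-≤ (K + k) (≤-pred i<k) ⟩
    K + k ∸ i      ≡⟨ cong (_∸ i) 2k∸1≡K+k ⟨
    2 * k ∸ 1 ∸ i  ∎
    where open ≤-Reasoning

  foldIndex-mirror : ∀ i → i < k → foldIndex k (2 * k ∸ 1 ∸ i) ≡ i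
  foldIndex-mirror i i<k rewrite ≮⇒<ᵇ≡false (≤⇒≯ (mirror≥k i i<k)) =
    m∸[m∸n]≡n (≤-trans (≤-pred i<k) (subst (K ≤_) (sym 2k∸1≡K+k) (m≤m+n K k)))

  mirror<2k : ∀ i → 2 * k ∸ 1 ∸ i < 2 * k
  mirror<2k i = s≤s (m∸n≤m (2 * k ∸ 1) i)

  beadAt-alphaRunner : ∀ r j → beadAt (alphaRunner k r) j ≡ runnerBead k (foldIndex k r) j
  beadAt-alphaRunner r j =
    trans (beadAt-runnerContent i (K ∸ i) j) (cong (λ n → runnerBead (suc n) i j) (m∸n+n≡m (≤-pred (foldIndex<k r))))
    where i = foldIndex k r

  runnerBead-foldIndex : ∀ r j → runnerBead k (foldIndex k r) j
                              ≡ (if r <ᵇ k then runnerBead k r j else runnerBead k (2 * k ∸ 1 ∸ r) j)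
  runnerBead-foldIndex r j with r <ᵇ k
  ... | true  = refl
  ... | false = refl

  alphaBead≡beadsOf : ∀ z → alphaBead k z ≡ beadsOf (alphaRunner k) z
  alphaBead≡beadsOf z = sym (trans (beadAt-alphaRunner (z % s) (z / s)) (runnerBead-foldIndex (z % s) (z / s)))

  alphaRunner-below : ∀ r → BeadsBelow (2 * k ∸ 2) (alphaRunner k r)
  alphaRunner-below r j bead =
    <ᵇ≡true⇒< j (2 * k ∸ 2) (proj₁ (∧≡true (trans (sym (beadAt-alphaRunner r j)) bead)))

  alphaRunner-count : ∀ r → countBeads (alphaRunner k r) ≡ K
  alphaRunner-count r = trans (countBeads-runnerContent i (K ∸ i)) (m+[n∸m]≡n (≤-pred (foldIndex<k r)))
    where i = foldIndex k r

  N : ℕ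
  N = alphaBound k

  alpha-core : IsCore (2 * k) (partitionOf (alphaBead k) N) []
  alpha-core =
    subst₂ (Star (RemoveRimHook s)) (partitionOf-cong (sym ∘ alphaBead≡beadsOf) N)
           (settled-empty (alphaRunner k) N K (λ r _ → alphaRunner-count r))
           (settleFirst-removesRimHooks (alphaRunner k) (2 * k ∸ 2) N (≤-reflexive (*-comm _ s))
                                         (λ r _ → alphaRunner-below r) s ≤-refl) ,
    λ ν → empty-noRimHook

  alpha-quotient : 0 < K → ∀ r → r < 2 * k → quotientPart (2 * k) (alphaBead k) N r ≡ tau (K ∸ foldIndex k r)
  alpha-quotient 0<K r r<2k = begin
    partitionOf (runnerSet (2 * k) (alphaBead k) r) N   ≡⟨ partitionOf-cong runner≡ N ⟩
    partitionOf (beadAt (alphaRunner k r)) N            ≡⟨ cong (partitionOf (beadAt (alphaRunner k r))) (m+[n∸m]≡n i≤N) ⟨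
    partitionOf (beadAt (alphaRunner k r)) (i + (N ∸ i)) ≡⟨ partitionOf-runnerContent i (K ∸ i) (N ∸ i)
                                                              (m+n≤o⇒m≤o∸n (length (false ∷ alternating (K ∸ i))) fits) ⟩
    tau (K ∸ i)                                         ∎
    where
      open ≡-Reasoning
      i = foldIndex k r
      runner≡ : ∀ j → alphaBead k (r + j * s) ≡ beadAt (alphaRunner k r) j
      runner≡ j = trans (alphaBead≡beadsOf (r + j * s)) (beadsOf-position (alphaRunner k) r j r<2k)
      2k≤N : 2 * k ≤ N
      2k≤N = m≤m*n (2 * k) (2 * k ∸ 2)
               {{>-nonZero (subst (0 <_) (sym (cong (_∸ 2) (*-suc 2 K))) (*-monoʳ-< 2 0<K))}}
      fits : length (false ∷ alternating (K ∸ i)) + i ≤ N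
      fits = ≤-trans (subst (λ n → length (false ∷ alternating (K ∸ i)) + i ≤ 2 * suc n)
                            (m∸n+n≡m (≤-pred (foldIndex<k r))) (runnerContent-fits i (K ∸ i)))
                     2k≤N
      i≤N : i ≤ N
      i≤N = ≤-trans (m≤n+m i _) fits

  alpha-quotients : 0 < K → ∀ i → i < k
    → quotientPart (2 * k) (alphaBead k) N i ≡ tau (k ∸ i ∸ 1)
    × quotientPart (2 * k) (alphaBead k) N (2 * k ∸ 1 ∸ i) ≡ tau (k ∸ i ∸ 1)
  alpha-quotients 0<K i i<k =
    trans (alpha-quotient 0<K i (≤-trans i<k (m≤m+n k (k + 0)))) (tau-index i (foldIndex-low i i<k)) ,
    trans (alpha-quotient 0<K (2 * k ∸ 1 ∸ i) (mirror<2k i)) (tau-index (2 * k ∸ 1 ∸ i) (foldIndex-mirror i i<k))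
    where
      tau-index : ∀ r → foldIndex k r ≡ i → tau (K ∸ foldIndex k r) ≡ tau (k ∸ i ∸ 1)
      tau-index r r↦i = cong tau (trans (cong (K ∸_) r↦i) (sym (trans (∸-+-assoc k i 1) (cong (k ∸_) (+-comm i 1)))))

lemma3p8 : (k : ℕ) → 2 ≤ k →
    IsCore (2 * k) (partitionOf (alphaBead k) (alphaBound k)) []
    × ((i : ℕ) → i < k →
         (quotientPart (2 * k) (alphaBead k) (alphaBound k) i ≡ tau (k ∸ i ∸ 1))
         × (quotientPart (2 * k) (alphaBead k) (alphaBound k) (2 * k ∸ 1 ∸ i) ≡ tau (k ∸ i ∸ 1)))
lemma3p8 (suc K) (s≤s 0<K) = alpha-core , alpha-quotients 0<K
  where open Alpha K
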